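{- Let $\lambda=[\lambda_1,\ldots,\lambda_k]$ be a partition of length $k$ and $n$ a positive integer. If $1\le k<n$, the dimension of $P(\lambda,n)$ is $\lambda_1(n-1)$. If $k=n$, the dimension of $P(\lambda,n)$ is $(\lambda_1-\lambda_n)(n-1)$.
   Context: A partition is a weakly decreasing sequence of positive integers; $a_i$ is the number of parts equal to $i$. A sign matrix is a matrix with entries in $\{ -1,0,1\}$ whose column partial sums from the top lie in $\{0,1\}$ and whose row partial sums from the left are nonnegative. $M(\lambda,n)$ is the set of $\lambda_1\times n$ sign matrices whose $i$-th row sums to $a_{\lambda_1-i+1}$ for each $i$; $P(\lambda,n)$ is its convex hull in $\mathbb{R}^{\lambda_1 n}$. -}

module Defs where

open import Data.Nat as ℕ using (ℕ; zero; suc; _∸_; _≟_)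
open import Data.Integer using (ℤ; +_; -[1+_]; _+_; _*_; _≤_)
open import Data.Fin using (Fin; toℕ)
import Data.Fin as Fin
open import Data.Vec using (Vec; []; _∷_; lookup; count)
open import Data.Product using (Σ; _×_; _,_)
open import Data.Sum using (_⊎_)
open import Relation.Binary.PropositionalEquality using (_≡_)
open import Relation.Nullary using (¬_)

IsPartition : ∀ {k} → Vec ℕ k → Set
IsPartition {k} λs =
  (∀ (i : Fin k) → 1 ℕ.≤ lookup λs i) ×
  (∀ (i j : Fin k) → i Fin.≤ j → lookup λs j ℕ.≤ lookup λs i)

firstPart : ∀ {k} → Vec ℕ k → ℕ
firstPart [] = 0
firstPart (x ∷ _) = x

lastPart : ∀ {k} → Vec ℕ k → ℕ
lastPart [] = 0
lastPart (x ∷ []) = x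
lastPart (_ ∷ y ∷ ys) = lastPart (y ∷ ys)

mult : ∀ {k} → Vec ℕ k → ℕ → ℕ
mult λs i = count (_≟ i) λs

-- sum of the first t entries of f (the full sum if t ≥ m)
sumUpTo : ∀ {m} → (Fin m → ℤ) → ℕ → ℤ
sumUpTo {zero} f t = + 0
sumUpTo {suc m} f zero = + 0
sumUpTo {suc m} f (suc t) = f Fin.zero + sumUpTo (λ i → f (Fin.suc i)) t

sumAll : ∀ {m} → (Fin m → ℤ) → ℤ
sumAll {m} f = sumUpTo f m

-- real matrices with p rows and n columns, entries here integers
Mat : ℕ → ℕ → Set
Mat p n = Fin p → Fin n → ℤ

IsSignEntry : ℤ → Set
IsSignEntry x = (x ≡ -[1+ 0 ]) ⊎ (x ≡ + 0) ⊎ (x ≡ + 1)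

IsSignMatrix : ∀ {p n} → Mat p n → Set
IsSignMatrix {p} {n} A =
  (∀ r j → IsSignEntry (A r j)) ×
  (∀ (j : Fin n) (t : ℕ) → (sumUpTo (λ r → A r j) t ≡ + 0) ⊎ (sumUpTo (λ r → A r j) t ≡ + 1)) ×
  (∀ (r : Fin p) (t : ℕ) → + 0 ≤ sumUpTo (A r) t)

-- M(λ,n): λ₁ × n sign matrices whose i-th row (1-indexed) sums to a_{λ₁-i+1};
-- with 0-indexed row r this is a_{λ₁ - r}.
InM : ∀ {k} (λs : Vec ℕ k) (n : ℕ) → Mat (firstPart λs) n → Set
InM λs n A = IsSignMatrix A ×
  (∀ (r : Fin (firstPart λs)) → sumAll (A r) ≡ + mult λs (firstPart λs ∸ toℕ r))

-- Affine independence of d+1 points of ℤ^{p×n} (coefficients in ℤ; for integer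
-- points this is equivalent to affine independence over ℚ or ℝ).
AffIndep : ∀ {p n d} → (Fin (suc d) → Mat p n) → Set
AffIndep {p} {n} {d} v =
  ∀ (c : Fin (suc d) → ℤ) → sumAll c ≡ + 0 →
  (∀ r j → sumAll (λ i → c i * v i r j) ≡ + 0) →
  ∀ i → c i ≡ + 0

-- The convex hull of S has dimension d: the affine hull of S (= that of its
-- convex hull) has dimension d, i.e. S contains d+1 affinely independent
-- points but no d+2 affinely independent points.
HullDim : ∀ {p n} → (Mat p n → Set) → ℕ → Set
HullDim {p} {n} S d =
  Σ (Fin (suc d) → Mat p n) (λ v → (∀ i → S (v i)) × AffIndep v) ×
  (∀ (v : Fin (suc (suc d)) → Mat p n) → (∀ i → S (v i)) → ¬ AffIndep v)

module Submission where

-- A matrix of M(λ,n) is determined by its column partial sums: with L = λ₁, the 0/1 vectors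
-- X₀ = 0, X₁, …, X_L, where X_t has w_t = #{parts ≥ L + 1 - t} ones; the row conditions say that
-- the prefix sums of X_t are bounded by those of X_{t+1}.
--
-- Row sums are fixed, so the last entry of each row is determined by the others. If
-- k = n then w_t = n for t > R = L - λₙ, which forces X_t = (1,…,1), so all rows from row R on
-- vanish. Hence (with R = L when k < n) an affine combination of points is determined by its
-- entries in the first R rows and first n - 1 columns, and any R(n-1) + 2 points are affinely
-- dependent.
--
-- For 1 ≤ t ≤ R we have 0 < w_t < n. Packing the ones of X_t to the right for t < ρ
-- and to the left for t > ρ leaves X_ρ free to be any vector of weight w_ρ, in particular one of
-- the n - 1 vectors obtained from the left-packed one by moving a single one. Together with the
-- matrix whose X_t are all left-packed this gives R(n-1) + 1 points, and the values of X_ρ at the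
-- moved positions form a triangular system, so the points are affinely independent.

open import Defs
open import Data.Nat as ℕ using (ℕ; zero; suc; _∸_; _⊓_; _≤_; _<_; z≤n; s≤s; _≤?_; _<?_; _≟_)
import Data.Nat.Properties as ℕₚ
import Algebra.Properties.CommutativeSemigroup ℕₚ.+-commutativeSemigroup as ℕ+
open import Data.Integer as ℤ using (ℤ; +_; _+_; _*_; _-_; -_; +≤+)
import Data.Integer.Properties as ℤₚ
import Algebra.Properties.CommutativeSemigroup ℤₚ.+-commutativeSemigroup as ℤ+
open import Data.Integer.Tactic.RingSolver using (solve-∀)
open import Data.Fin as Fin using (Fin; zero; suc; toℕ; punchIn)
import Data.Fin.Properties as Finₚ
open import Data.Vec using (Vec; []; _∷_; lookup; count)
open import Data.Vec.Properties using (count≤n)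
open import Data.Vec.Functional using (insertAt; tail)
open import Data.Vec.Functional.Properties using (insertAt-lookup; insertAt-punchIn)
open import Data.Product using (Σ; ∃; _×_; _,_; proj₁; proj₂)
open import Data.Sum as Sum using (_⊎_; inj₁; inj₂; [_,_]′)
open import Function using (_∘_)
open import Data.Empty using (⊥-elim)
open import Data.Fin.Induction using (>-wellFounded; Acc; acc)
open import Relation.Binary using (tri<; tri≈; tri>)
open import Relation.Nullary using (¬_; yes; no)
open import Relation.Unary using (Decidable)
open import Relation.Binary.PropositionalEquality

sumUpTo-zero< : ∀ {m} (f : Fin m → ℤ) t → (∀ i → toℕ i < t → f i ≡ + 0) → sumUpTo f t ≡ + 0
sumUpTo-zero< {zero}  f t       f≡0 = refl
sumUpTo-zero< {suc m} f zero    f≡0 = refl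
sumUpTo-zero< {suc m} f (suc t) f≡0 =
  cong₂ _+_ (f≡0 zero (s≤s z≤n)) (sumUpTo-zero< (tail f) t (λ i i<t → f≡0 (suc i) (s≤s i<t)))

sumUpTo-zero : ∀ {m} {f : Fin m → ℤ} → (∀ i → f i ≡ + 0) → ∀ t → sumUpTo f t ≡ + 0
sumUpTo-zero {f = f} f≡0 t = sumUpTo-zero< f t (λ i _ → f≡0 i)

sumUpTo-cong : ∀ {m} {f g : Fin m → ℤ} → (∀ i → f i ≡ g i) → ∀ t → sumUpTo f t ≡ sumUpTo g t
sumUpTo-cong {zero}  f≡g t       = refl
sumUpTo-cong {suc m} f≡g zero    = refl
sumUpTo-cong {suc m} f≡g (suc t) = cong₂ _+_ (f≡g zero) (sumUpTo-cong (λ i → f≡g (suc i)) t)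

sumUpTo-+ : ∀ {m} (f g : Fin m → ℤ) t → sumUpTo (λ i → f i + g i) t ≡ sumUpTo f t + sumUpTo g t
sumUpTo-+ {zero}  f g t       = refl
sumUpTo-+ {suc m} f g zero    = refl
sumUpTo-+ {suc m} f g (suc t) rewrite sumUpTo-+ (tail f) (tail g) t =
  ℤ+.interchange (f zero) (g zero) (sumUpTo (tail f) t) (sumUpTo (tail g) t)

sumUpTo-*ˡ : ∀ {m} a (f : Fin m → ℤ) t → sumUpTo (λ i → a * f i) t ≡ a * sumUpTo f t
sumUpTo-*ˡ {zero}  a f t       = sym (ℤₚ.*-zeroʳ a)
sumUpTo-*ˡ {suc m} a f zero    = sym (ℤₚ.*-zeroʳ a)
sumUpTo-*ˡ {suc m} a f (suc t) rewrite sumUpTo-*ˡ a (tail f) t = sym (ℤₚ.*-distribˡ-+ a _ _)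

sumUpTo-*ʳ : ∀ {m} a (f : Fin m → ℤ) t → sumUpTo (λ i → f i * a) t ≡ sumUpTo f t * a
sumUpTo-*ʳ a f t =
  trans (sumUpTo-cong (λ i → ℤₚ.*-comm (f i) a) t) (trans (sumUpTo-*ˡ a f t) (ℤₚ.*-comm a _))

sumUpTo-swap : ∀ {m m′} (g : Fin m → Fin m′ → ℤ) t t′ →
  sumUpTo (λ i → sumUpTo (g i) t′) t ≡ sumUpTo (λ j → sumUpTo (λ i → g i j) t) t′
sumUpTo-swap {zero}  {m′} g t       t′ = sym (sumUpTo-zero {m′} (λ _ → refl) t′)
sumUpTo-swap {suc m} {m′} g zero    t′ = sym (sumUpTo-zero {m′} (λ _ → refl) t′)
sumUpTo-swap {suc m} g (suc t) t′ rewrite sumUpTo-swap (tail g) t t′ =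
  sym (sumUpTo-+ (g zero) (λ j → sumUpTo (λ i → g (suc i) j) t) t′)

sumUpTo-⊓ : ∀ {m} (f : Fin m → ℤ) t → sumUpTo f t ≡ sumUpTo f (t ⊓ m)
sumUpTo-⊓ {zero}  f t       = refl
sumUpTo-⊓ {suc m} f zero    = refl
sumUpTo-⊓ {suc m} f (suc t) = cong (_+_ (f zero)) (sumUpTo-⊓ (tail f) t)

sumUpTo-suc : ∀ {m} (f : Fin m → ℤ) (i : Fin m) → sumUpTo f (suc (toℕ i)) ≡ sumUpTo f (toℕ i) + f i
sumUpTo-suc {suc m}       f (suc i) rewrite sumUpTo-suc (tail f) i = sym (ℤₚ.+-assoc (f zero) _ _)
sumUpTo-suc {suc zero}    f zero    = trans (ℤₚ.+-identityʳ (f zero)) (sym (ℤₚ.+-identityˡ (f zero)))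
sumUpTo-suc {suc (suc m)} f zero    = trans (ℤₚ.+-identityʳ (f zero)) (sym (ℤₚ.+-identityˡ (f zero)))

sumAll-punchIn : ∀ {m} (f : Fin (suc m) → ℤ) j → sumAll f ≡ f j + sumAll (λ i → f (punchIn j i))
sumAll-punchIn         f zero    = refl
sumAll-punchIn {suc m} f (suc j) rewrite sumAll-punchIn (tail f) j = +-swap (f zero) (f (suc j)) _
  where
  +-swap : ∀ a b c → a + (b + c) ≡ b + (a + c)
  +-swap = solve-∀

sumAll-single : ∀ {m} (f : Fin m → ℤ) j → (∀ i → i ≢ j → f i ≡ + 0) → sumAll f ≡ f j
sumAll-single {suc m} f j f≡0 = begin
  sumAll f                              ≡⟨ sumAll-punchIn f j ⟩
  f j + sumAll (λ i → f (punchIn j i))  ≡⟨ cong (_+_ (f j)) (sumUpTo-zero (λ i → f≡0 _ (Finₚ.punchInᵢ≢i j i)) m) ⟩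
  f j + + 0                             ≡⟨ ℤₚ.+-identityʳ (f j) ⟩
  f j                                   ∎
  where open ≡-Reasoning

sumAll-*-constant : ∀ {m} (c g : Fin m → ℤ) a → sumAll c ≡ + 0 → (∀ i → g i ≡ a) → sumAll (λ i → c i * g i) ≡ + 0
sumAll-*-constant {m} c g a Σc≡0 g≡a = begin
  sumAll (λ i → c i * g i)  ≡⟨ sumUpTo-cong (λ i → cong (c i *_) (g≡a i)) m ⟩
  sumAll (λ i → c i * a)    ≡⟨ sumUpTo-*ʳ a c m ⟩
  sumAll c * a              ≡⟨ cong (_* a) Σc≡0 ⟩
  + 0 * a                   ≡⟨ ℤₚ.*-zeroˡ a ⟩
  + 0                       ∎
  where open ≡-Reasoning

sumAll-≤ : ∀ {m} (f : Fin m → ℤ) → (∀ j → f j ℤ.≤ + 1) → sumAll f ℤ.≤ + m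
sumAll-≤ {zero}  f f≤1 = +≤+ z≤n
sumAll-≤ {suc m} f f≤1 = ℤₚ.+-mono-≤ (f≤1 zero) (sumAll-≤ (tail f) (λ j → f≤1 (suc j)))

sumAll≡m⇒≡1 : ∀ {m} (f : Fin m → ℤ) → (∀ j → (f j ≡ + 0) ⊎ (f j ≡ + 1)) → sumAll f ≡ + m → ∀ j → f j ≡ + 1
sumAll≡m⇒≡1 {suc m} f f≡0∨1 Σf≡m j with f≡0∨1 j
... | inj₂ fj≡1 = fj≡1
... | inj₁ fj≡0 = ⊥-elim (ℕₚ.<-irrefl refl (ℤₚ.drop‿+≤+ (begin
  + suc m                                   ≡⟨ Σf≡m ⟨
  sumAll f                                  ≡⟨ sumAll-punchIn f j ⟩
  f j + sumAll (λ i → f (punchIn j i))      ≡⟨ cong (_+ sumAll (λ i → f (punchIn j i))) fj≡0 ⟩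
  + 0 + sumAll (λ i → f (punchIn j i))      ≡⟨ ℤₚ.+-identityˡ _ ⟩
  sumAll (λ i → f (punchIn j i))            ≤⟨ sumAll-≤ _ (λ i → ≤1 (f≡0∨1 (punchIn j i))) ⟩
  + m                                       ∎)))
  where
  open ℤₚ.≤-Reasoning
  ≤1 : ∀ {x} → (x ≡ + 0) ⊎ (x ≡ + 1) → x ℤ.≤ + 1
  ≤1 (inj₁ refl) = +≤+ z≤n
  ≤1 (inj₂ refl) = ℤₚ.≤-refl

-- Affine dependence and independence

lincomb : ∀ {N p n} → (Fin N → ℤ) → (Fin N → Mat p n) → Mat p n
lincomb c v r j = sumAll (λ i → c i * v i r j)

lincomb-rowSum : ∀ {N p n} (c : Fin N → ℤ) (v : Fin N → Mat p n) r t →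
  sumUpTo (lincomb c v r) t ≡ sumAll (λ i → c i * sumUpTo (v i r) t)
lincomb-rowSum {N} c v r t = trans (sym (sumUpTo-swap (λ i j → c i * v i r j) N t))
  (sumUpTo-cong (λ i → sumUpTo-*ˡ (c i) (v i r) t) N)

lincomb-colSum : ∀ {N p n} (c : Fin N → ℤ) (v : Fin N → Mat p n) j t →
  sumUpTo (λ r → lincomb c v r j) t ≡ sumAll (λ i → c i * sumUpTo (λ r → v i r j) t)
lincomb-colSum {N} c v j t = trans (sym (sumUpTo-swap (λ i r → c i * v i r j) N t))
  (sumUpTo-cong (λ i → sumUpTo-*ˡ (c i) (λ r → v i r j) t) N)

Nontrivial : ∀ {N} → (Fin N → ℤ) → Set
Nontrivial c = ∃ λ i → c i ≢ + 0

IsRelation : ∀ {N m} → (Fin N → ℤ) → (Fin N → Fin m → ℤ) → Set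
IsRelation c w = ∀ x → sumAll (λ i → c i * w i x) ≡ + 0

sumAll-insertAt : ∀ {m} (c : Fin m → ℤ) j a (g : Fin (suc m) → ℤ) →
  sumAll (λ i → insertAt c j a i * g i) ≡ a * g j + sumAll (λ i → c i * g (punchIn j i))
sumAll-insertAt {m} c j a g = trans (sumAll-punchIn (λ i → insertAt c j a i * g i) j)
  (cong₂ _+_ (cong (_* g j) (insertAt-lookup c j a))
             (sumUpTo-cong (λ i → cong (_* g (punchIn j i)) (insertAt-punchIn c j a i)) m))

eliminate : ∀ {m} → (Fin (suc (suc m)) → Fin (suc m) → ℤ) → Fin (suc (suc m)) → Fin (suc m) → Fin m → ℤ
eliminate w j i x = w j zero * w (punchIn j i) (suc x) - w (punchIn j i) zero * w j (suc x)

eliminate-relation : ∀ {m} (w : Fin (suc (suc m)) → Fin (suc m) → ℤ) j → w j zero ≢ + 0 →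
  ∀ c′ → Nontrivial c′ → IsRelation c′ (eliminate w j) → ∃ λ c → Nontrivial c × IsRelation c w
eliminate-relation {m} w j pivot≢0 c′ (i₀ , c′i₀≢0) rel = c , (punchIn j i₀ , cᵢ₀≢0) , c-rel
  where
  a : Fin (suc (suc m)) → ℤ
  a i = w i zero
  a′ : Fin (suc m) → ℤ
  a′ i = a (punchIn j i)
  S = sumAll (λ i → c′ i * a′ i)
  c = insertAt (λ i → a j * c′ i) j (- S)

  cᵢ₀≢0 : c (punchIn j i₀) ≢ + 0
  cᵢ₀≢0 cᵢ₀≡0 = [ pivot≢0 , c′i₀≢0 ]′ (ℤₚ.i*j≡0⇒i≡0∨j≡0 (a j)
    (trans (sym (insertAt-punchIn (λ i → a j * c′ i) j (- S) i₀)) cᵢ₀≡0))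

  c-rel : IsRelation c w
  c-rel zero = begin
    sumAll (λ i → c i * a i)                          ≡⟨ sumAll-insertAt _ j (- S) a ⟩
    - S * a j + sumAll (λ i → (a j * c′ i) * a′ i)    ≡⟨ cong (_+_ (- S * a j)) (sumUpTo-cong (λ i → ℤₚ.*-assoc (a j) (c′ i) (a′ i)) (suc m)) ⟩
    - S * a j + sumAll (λ i → a j * (c′ i * a′ i))    ≡⟨ cong (_+_ (- S * a j)) (sumUpTo-*ˡ (a j) (λ i → c′ i * a′ i) (suc m)) ⟩
    - S * a j + a j * S                               ≡⟨ cancel S (a j) ⟩
    + 0                                               ∎
    where
    open ≡-Reasoning
    cancel : ∀ s b → - s * b + b * s ≡ + 0
    cancel = solve-∀
  c-rel (suc x) = begin
    sumAll (λ i → c i * w i (suc x))                         ≡⟨ sumAll-insertAt _ j (- S) (λ i → w i (suc x)) ⟩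
    - S * V + T                                              ≡⟨ regroup S V T ⟩
    T + S * - V                                              ≡⟨ cong (_+_ T) (sumUpTo-*ʳ (- V) (λ i → c′ i * a′ i) (suc m)) ⟨
    T + sumAll (λ i → (c′ i * a′ i) * - V)                   ≡⟨ sumUpTo-+ (λ i → (a j * c′ i) * W i) (λ i → (c′ i * a′ i) * - V) (suc m) ⟨
    sumAll (λ i → (a j * c′ i) * W i + (c′ i * a′ i) * - V)  ≡⟨ sumUpTo-cong (λ i → factor (c′ i) (a j) (W i) (a′ i) V) (suc m) ⟩
    sumAll (λ i → c′ i * eliminate w j i x)                  ≡⟨ rel x ⟩
    + 0                                                      ∎
    where
    open ≡-Reasoning
    V = w j (suc x)
    W : Fin (suc m) → ℤ
    W i = w (punchIn j i) (suc x)
    T = sumAll (λ i → (a j * c′ i) * W i)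
    regroup : ∀ s v t → - s * v + t ≡ t + s * - v
    regroup = solve-∀
    factor : ∀ c b W′ a′ v → (b * c) * W′ + (c * a′) * - v ≡ c * (b * W′ - a′ * v)
    factor = solve-∀

linearDependence : ∀ m (w : Fin (suc m) → Fin m → ℤ) → ∃ λ c → Nontrivial c × IsRelation c w
linearDependence zero    w = (λ _ → + 1) , (zero , λ ()) , λ ()
linearDependence (suc m) w with Finₚ.all? (λ i → w i zero ℤ.≟ + 0)
... | no ¬column≡0 = let (j , pivot≢0) = Finₚ.¬∀⟶∃¬ _ _ (λ i → w i zero ℤ.≟ + 0) ¬column≡0
                         (c′ , c′≢0 , rel) = linearDependence m (eliminate w j)
                     in eliminate-relation w j pivot≢0 c′ c′≢0 rel
... | yes column≡0 = let (c′ , (i₀ , c′i₀≢0) , rel) = linearDependence m (λ i x → w (suc i) (suc x))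
                     in insertAt c′ zero (+ 0) , (suc i₀ , c′i₀≢0) , c-rel c′ rel
  where
  c-rel : ∀ c′ → IsRelation c′ (λ i x → w (suc i) (suc x)) → IsRelation (insertAt c′ zero (+ 0)) w
  c-rel c′ rel zero    = sumUpTo-zero {f = λ i → insertAt c′ zero (+ 0) i * w i zero} (λ where
    zero    → ℤₚ.*-zeroˡ (w zero zero)
    (suc i) → trans (cong (c′ i *_) (column≡0 (suc i))) (ℤₚ.*-zeroʳ (c′ i))) (suc (suc m))
  c-rel c′ rel (suc x) = begin
    + 0 * w zero (suc x) + Σ′     ≡⟨ cong (_+ Σ′) (ℤₚ.*-zeroˡ (w zero (suc x))) ⟩
    + 0 + Σ′                      ≡⟨ ℤₚ.+-identityˡ Σ′ ⟩
    Σ′                            ≡⟨ rel x ⟩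
    + 0                           ∎
    where
    open ≡-Reasoning
    Σ′ = sumAll (λ i → c′ i * w (suc i) (suc x))

AffinelyDeterminedAt : ∀ {p n d} → (Mat p n → Set) → (Fin d → Fin p) → (Fin d → Fin n) → Set
AffinelyDeterminedAt {p} {n} S row col =
  ∀ {N} (c : Fin N → ℤ) (v : Fin N → Mat p n) → (∀ i → S (v i)) → sumAll c ≡ + 0 →
  (∀ x → lincomb c v (row x) (col x) ≡ + 0) → ∀ r j → lincomb c v r j ≡ + 0

¬AffIndep-determinedAt : ∀ {p n d} {S : Mat p n → Set} (row : Fin d → Fin p) (col : Fin d → Fin n) →
  AffinelyDeterminedAt S row col → ∀ (v : Fin (suc (suc d)) → Mat p n) → (∀ i → S (v i)) → ¬ AffIndep v
¬AffIndep-determinedAt {d = d} row col determined v v∈S affIndep = cᵢ₀≢0 (affIndep c Σc≡0 lincomb≡0 i₀)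
  where
  w : Fin (suc (suc d)) → Fin (suc d) → ℤ
  w i zero    = + 1
  w i (suc x) = v i (row x) (col x)
  dependence = linearDependence (suc d) w
  c = proj₁ dependence
  i₀ = proj₁ (proj₁ (proj₂ dependence))
  cᵢ₀≢0 = proj₂ (proj₁ (proj₂ dependence))
  rel = proj₂ (proj₂ dependence)
  Σc≡0 : sumAll c ≡ + 0
  Σc≡0 = trans (sumUpTo-cong (λ i → sym (ℤₚ.*-identityʳ (c i))) (suc (suc d))) (rel zero)
  lincomb≡0 = determined c v v∈S Σc≡0 (λ x → rel (suc x))

triangular⇒AffIndep : ∀ {p n d} (u : Fin (suc d) → Mat p n) (f : Fin d → Mat p n → ℤ) →
  (∀ x c → f x (lincomb c u) ≡ sumAll (λ i → c i * f x (u i))) →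
  (∀ x M → (∀ r j → M r j ≡ + 0) → f x M ≡ + 0) →
  (∀ x y → y Fin.< x → f x (u (suc y)) ≡ f x (u zero)) →
  (∀ x → f x (u (suc x)) ≢ f x (u zero)) →
  AffIndep u
triangular⇒AffIndep {d = d} u f f-linear f-zero below diagonal c Σc≡0 lincomb≡0 = c≡0
  where
  Δ : Fin d → Fin d → ℤ
  Δ x y = f x (u (suc y)) - f x (u zero)
  relation : ∀ x → sumAll (λ y → c (suc y) * Δ x y) ≡ + 0
  relation x = begin
    sumAll (λ y → c (suc y) * Δ x y)                              ≡⟨ sym (absorb (c zero) F (sumAll (λ y → c (suc y) * Δ x y))) ⟩
    sumAll (λ i → c i * (f x (u i) - F))                          ≡⟨ sumUpTo-cong (λ i → ℤₚ.*-distribˡ-+ (c i) (f x (u i)) (- F)) (suc d) ⟩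
    sumAll (λ i → c i * f x (u i) + c i * - F)                    ≡⟨ sumUpTo-+ (λ i → c i * f x (u i)) (λ i → c i * - F) (suc d) ⟩
    sumAll (λ i → c i * f x (u i)) + sumAll (λ i → c i * - F)     ≡⟨ cong₂ _+_ (trans (sym (f-linear x c)) (f-zero x (lincomb c u) lincomb≡0))
                                                                              (sumAll-*-constant c (λ _ → - F) (- F) Σc≡0 (λ _ → refl)) ⟩
    + 0                                                           ∎
    where
    open ≡-Reasoning
    F = f x (u zero)
    absorb : ∀ a b s → a * (b - b) + s ≡ s
    absorb = solve-∀
  c-suc≡0 : ∀ x → Acc Fin._>_ x → c (suc x) ≡ + 0
  c-suc≡0 x (acc larger) with ℤₚ.i*j≡0⇒i≡0∨j≡0 (c (suc x)) (trans (sym (sumAll-single _ x others)) (relation x))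
    where
    others : ∀ y → y ≢ x → c (suc y) * Δ x y ≡ + 0
    others y y≢x with Finₚ.<-cmp y x
    ... | tri< y<x _ _ = trans (cong (c (suc y) *_) (ℤₚ.i≡j⇒i-j≡0 (below x y y<x))) (ℤₚ.*-zeroʳ (c (suc y)))
    ... | tri≈ _ y≡x _ = ⊥-elim (y≢x y≡x)
    ... | tri> _ _ y>x = trans (cong (_* Δ x y) (c-suc≡0 y (larger y>x))) (ℤₚ.*-zeroˡ (Δ x y))
  ... | inj₁ cₓ≡0 = cₓ≡0
  ... | inj₂ Δₓₓ≡0 = ⊥-elim (diagonal x (ℤₚ.i-j≡0⇒i≡j _ _ Δₓₓ≡0))
  c≡0 : ∀ i → c i ≡ + 0
  c≡0 (suc x) = c-suc≡0 x (>-wellFounded x)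
  c≡0 zero    = begin
    c zero                                    ≡⟨ sym (ℤₚ.+-identityʳ (c zero)) ⟩
    c zero + + 0                              ≡⟨ cong (_+_ (c zero)) (sym (sumUpTo-zero (λ x → c≡0 (suc x)) d)) ⟩
    c zero + sumAll (λ x → c (suc x))         ≡⟨ Σc≡0 ⟩
    + 0                                       ∎
    where open ≡-Reasoning

sumℕ : ℕ → (ℕ → ℕ) → ℕ
sumℕ zero    g = 0
sumℕ (suc J) g = g 0 ℕ.+ sumℕ J (λ j → g (suc j))

sumℤ : ℕ → (ℕ → ℤ) → ℤ
sumℤ zero    g = + 0
sumℤ (suc J) g = g 0 + sumℤ J (λ j → g (suc j))

sumUpTo-toℕ : ∀ {m} (g : ℕ → ℤ) J → J ≤ m → sumUpTo {m} (λ i → g (toℕ i)) J ≡ sumℤ J g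
sumUpTo-toℕ {zero}  g zero    J≤m       = refl
sumUpTo-toℕ {suc m} g zero    J≤m       = refl
sumUpTo-toℕ {suc m} g (suc J) (s≤s J≤m) = cong (_+_ (g 0)) (sumUpTo-toℕ (λ j → g (suc j)) J J≤m)

sumℤ-ofℕ : ∀ J (g : ℕ → ℕ) → sumℤ J (λ j → + g j) ≡ + sumℕ J g
sumℤ-ofℕ zero    g = refl
sumℤ-ofℕ (suc J) g = cong (_+_ (+ g 0)) (sumℤ-ofℕ J (λ j → g (suc j)))

sumℤ-sub : ∀ J (f g : ℕ → ℤ) → sumℤ J (λ j → f j - g j) ≡ sumℤ J f - sumℤ J g
sumℤ-sub zero    f g = refl
sumℤ-sub (suc J) f g rewrite sumℤ-sub J (λ j → f (suc j)) (λ j → g (suc j)) = regroup (f 0) (g 0) _ _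
  where
  regroup : ∀ a b c d → a - b + (c - d) ≡ a + c - (b + d)
  regroup = solve-∀

sumℤ-telescope : ∀ T (h : ℕ → ℤ) → sumℤ T (λ t → h (suc t) - h t) ≡ h T - h 0
sumℤ-telescope zero    h = sym (ℤₚ.+-inverseʳ (h 0))
sumℤ-telescope (suc T) h rewrite sumℤ-telescope T (λ t → h (suc t)) = collapse (h 0) (h 1) (h (suc T))
  where
  collapse : ∀ a b c → b - a + (c - b) ≡ c - a
  collapse = solve-∀

sumℕ-+ : ∀ J (f g : ℕ → ℕ) → sumℕ J (λ j → f j ℕ.+ g j) ≡ sumℕ J f ℕ.+ sumℕ J g
sumℕ-+ zero    f g = refl
sumℕ-+ (suc J) f g rewrite sumℕ-+ J (λ j → f (suc j)) (λ j → g (suc j)) =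
  ℕ+.interchange (f 0) (g 0) (sumℕ J (λ j → f (suc j))) (sumℕ J (λ j → g (suc j)))

sumℕ-suc : ∀ J (g : ℕ → ℕ) → sumℕ (suc J) g ≡ sumℕ J g ℕ.+ g J
sumℕ-suc zero    g = ℕₚ.+-identityʳ (g 0)
sumℕ-suc (suc J) g rewrite sumℕ-suc J (λ j → g (suc j)) = sym (ℕₚ.+-assoc (g 0) _ _)

sumℕ-split : ∀ J K (g : ℕ → ℕ) → sumℕ (J ℕ.+ K) g ≡ sumℕ J g ℕ.+ sumℕ K (λ j → g (J ℕ.+ j))
sumℕ-split zero    K g = refl
sumℕ-split (suc J) K g rewrite sumℕ-split J K (λ j → g (suc j)) = sym (ℕₚ.+-assoc (g 0) _ _)

sumℕ-≤-length : ∀ K (g : ℕ → ℕ) → (∀ j → g j ≤ 1) → sumℕ K g ≤ K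
sumℕ-≤-length zero    g g≤1 = z≤n
sumℕ-≤-length (suc K) g g≤1 = ℕₚ.+-mono-≤ (g≤1 0) (sumℕ-≤-length K (λ j → g (suc j)) (λ j → g≤1 (suc j)))

sumℕ-mono : ∀ (g : ℕ → ℕ) {J n} → J ≤ n → sumℕ J g ≤ sumℕ n g
sumℕ-mono g {J} {n} J≤n = begin
  sumℕ J g                                         ≤⟨ ℕₚ.m≤m+n _ _ ⟩
  sumℕ J g ℕ.+ sumℕ (n ∸ J) (λ j → g (J ℕ.+ j))    ≡⟨ sumℕ-split J (n ∸ J) g ⟨
  sumℕ (J ℕ.+ (n ∸ J)) g                           ≡⟨ cong (λ m → sumℕ m g) (ℕₚ.m+[n∸m]≡n J≤n) ⟩
  sumℕ n g                                         ∎
  where open ℕₚ.≤-Reasoning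

sumℕ-≤-prefix : ∀ (g : ℕ → ℕ) {J n} → (∀ j → g j ≤ 1) → J ≤ n → sumℕ n g ≤ sumℕ J g ℕ.+ (n ∸ J)
sumℕ-≤-prefix g {J} {n} g≤1 J≤n = begin
  sumℕ n g                                         ≡⟨ cong (λ m → sumℕ m g) (ℕₚ.m+[n∸m]≡n J≤n) ⟨
  sumℕ (J ℕ.+ (n ∸ J)) g                           ≡⟨ sumℕ-split J (n ∸ J) g ⟩
  sumℕ J g ℕ.+ sumℕ (n ∸ J) (λ j → g (J ℕ.+ j))    ≤⟨ ℕₚ.+-monoʳ-≤ (sumℕ J g) (sumℕ-≤-length (n ∸ J) _ (λ j → g≤1 (J ℕ.+ j))) ⟩
  sumℕ J g ℕ.+ (n ∸ J)                             ∎
  where open ℕₚ.≤-Reasoning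

-- The indicator function of [b, c).
interval : ℕ → ℕ → ℕ → ℕ
interval zero    zero    _       = 0
interval zero    (suc c) zero    = 1
interval zero    (suc c) (suc j) = interval zero c j
interval (suc b) zero    _       = 0
interval (suc b) (suc c) zero    = 0
interval (suc b) (suc c) (suc j) = interval b c j

interval≤1 : ∀ b c j → interval b c j ≤ 1
interval≤1 zero    zero    _       = z≤n
interval≤1 zero    (suc c) zero    = s≤s z≤n
interval≤1 zero    (suc c) (suc j) = interval≤1 zero c j
interval≤1 (suc b) zero    _       = z≤n
interval≤1 (suc b) (suc c) zero    = z≤n
interval≤1 (suc b) (suc c) (suc j) = interval≤1 b c j

interval-inside : ∀ {b c j} → b ≤ j → j < c → interval b c j ≡ 1
interval-inside {zero}  {suc c} {zero}  _         _         = refl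
interval-inside {zero}  {suc c} {suc j} _         (s≤s j<c) = interval-inside {zero} z≤n j<c
interval-inside {suc b} {suc c} {suc j} (s≤s b≤j) (s≤s j<c) = interval-inside b≤j j<c

interval-below : ∀ {b c j} → j < b → interval b c j ≡ 0
interval-below {suc b} {zero}  {j}     _         = refl
interval-below {suc b} {suc c} {zero}  _         = refl
interval-below {suc b} {suc c} {suc j} (s≤s j<b) = interval-below j<b

interval-above : ∀ {b c j} → c ≤ j → interval b c j ≡ 0
interval-above {zero}  {zero}  {j}     _         = refl
interval-above {zero}  {suc c} {suc j} (s≤s c≤j) = interval-above {zero} c≤j
interval-above {suc b} {zero}  {j}     _         = refl
interval-above {suc b} {suc c} {suc j} (s≤s c≤j) = interval-above {b} c≤j

interval-empty : ∀ b j → interval b b j ≡ 0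
interval-empty zero    _       = refl
interval-empty (suc b) zero    = refl
interval-empty (suc b) (suc j) = interval-empty b j

sumℕ-interval : ∀ J b c → sumℕ J (interval b c) ≡ J ⊓ c ∸ b
sumℕ-interval zero    b       c       = sym (ℕₚ.0∸n≡0 b)
sumℕ-interval (suc J) zero    zero    = trans (sumℕ-interval J zero zero) (ℕₚ.⊓-zeroʳ J)
sumℕ-interval (suc J) zero    (suc c) = cong suc (sumℕ-interval J zero c)
sumℕ-interval (suc J) (suc b) zero    = trans (sumℕ-interval J (suc b) zero) (cong (_∸ suc b) (ℕₚ.⊓-zeroʳ J))
sumℕ-interval (suc J) (suc b) (suc c) = sumℕ-interval J b c

blocks : ℕ → ℕ → ℕ → ℕ → ℕ
blocks a b c j = interval 0 a j ℕ.+ interval b c j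

blocks≤1 : ∀ {a b} c j → a ≤ b → blocks a b c j ≤ 1
blocks≤1 {a} {b} c j a≤b with j <? a
... | yes j<a = subst (_≤ 1) (sym (cong (interval 0 a j ℕ.+_) (interval-below (ℕₚ.<-≤-trans j<a a≤b))))
                  (ℕₚ.≤-trans (ℕₚ.≤-reflexive (ℕₚ.+-identityʳ _)) (interval≤1 0 a j))
... | no  j≮a = subst (_≤ 1) (sym (cong (ℕ._+ interval b c j) (interval-above {0} (ℕₚ.≮⇒≥ j≮a)))) (interval≤1 b c j)

sumℕ-blocks : ∀ J a b c → sumℕ J (blocks a b c) ≡ J ⊓ a ℕ.+ (J ⊓ c ∸ b)
sumℕ-blocks J a b c = trans (sumℕ-+ J (interval 0 a) (interval b c)) (cong₂ ℕ._+_ (sumℕ-interval J 0 a) (sumℕ-interval J b c))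

-- Matrices with prescribed column partial sums

IsState : ℕ → ℕ → (ℕ → ℕ) → Set
IsState n w g = (∀ j → g j ≤ 1) × sumℕ n g ≡ w

_≼[_]_ : (ℕ → ℕ) → ℕ → (ℕ → ℕ) → Set
g ≼[ n ] h = ∀ J → J ≤ n → sumℕ J g ≤ sumℕ J h

-- X t is the vector of column partial sums after the first t rows.
stateMatrix : ∀ p n → (ℕ → ℕ → ℕ) → Mat p n
stateMatrix p n X r j = + X (suc (toℕ r)) (toℕ j) - + X (toℕ r) (toℕ j)

isSignEntry-diff : ∀ {a b} → a ≤ 1 → b ≤ 1 → IsSignEntry (+ a - + b)
isSignEntry-diff z≤n       z≤n       = inj₂ (inj₁ refl)
isSignEntry-diff z≤n       (s≤s z≤n) = inj₁ refl
isSignEntry-diff (s≤s z≤n) z≤n       = inj₂ (inj₂ refl)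
isSignEntry-diff (s≤s z≤n) (s≤s z≤n) = inj₂ (inj₁ refl)

≤1⇒0∨1 : ∀ {a} → a ≤ 1 → (+ a ≡ + 0) ⊎ (+ a ≡ + 1)
≤1⇒0∨1 z≤n       = inj₁ refl
≤1⇒0∨1 (s≤s z≤n) = inj₂ refl

module StateMatrix (p n : ℕ) (X : ℕ → ℕ → ℕ) where

  M = stateMatrix p n X

  colSum : (∀ j → X 0 j ≡ 0) → ∀ T → T ≤ p → ∀ j → sumUpTo (λ r → M r j) T ≡ + X T (toℕ j)
  colSum X₀≡0 T T≤p j = begin
    sumUpTo (λ r → M r j) T                                  ≡⟨ sumUpTo-toℕ (λ t → + X (suc t) (toℕ j) - + X t (toℕ j)) T T≤p ⟩
    sumℤ T (λ t → + X (suc t) (toℕ j) - + X t (toℕ j))       ≡⟨ sumℤ-telescope T (λ t → + X t (toℕ j)) ⟩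
    + X T (toℕ j) - + X 0 (toℕ j)                            ≡⟨ cong (λ x → + X T (toℕ j) - + x) (X₀≡0 (toℕ j)) ⟩
    + X T (toℕ j) - + 0                                      ≡⟨ ℤₚ.+-identityʳ _ ⟩
    + X T (toℕ j)                                            ∎
    where open ≡-Reasoning

  rowSum : (∀ t → t < p → X t ≼[ n ] X (suc t)) →
    ∀ r J → J ≤ n → sumUpTo (M r) J ≡ + (sumℕ J (X (suc (toℕ r))) ∸ sumℕ J (X (toℕ r)))
  rowSum X-mono r J J≤n = begin
    sumUpTo (M r) J                                          ≡⟨ sumUpTo-toℕ (λ j → + X⁺ j - + X⁻ j) J J≤n ⟩
    sumℤ J (λ j → + X⁺ j - + X⁻ j)                           ≡⟨ sumℤ-sub J (λ j → + X⁺ j) (λ j → + X⁻ j) ⟩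
    sumℤ J (λ j → + X⁺ j) - sumℤ J (λ j → + X⁻ j)            ≡⟨ cong₂ _-_ (sumℤ-ofℕ J X⁺) (sumℤ-ofℕ J X⁻) ⟩
    + sumℕ J X⁺ - + sumℕ J X⁻                                ≡⟨ ℤₚ.[+m]-[+n]≡m⊖n (sumℕ J X⁺) (sumℕ J X⁻) ⟩
    sumℕ J X⁺ ℤ.⊖ sumℕ J X⁻                                  ≡⟨ ℤₚ.≤-⊖ (X-mono (toℕ r) (Finₚ.toℕ<n r) J J≤n) ⟩
    + (sumℕ J X⁺ ∸ sumℕ J X⁻)                                ∎
    where
    open ≡-Reasoning
    X⁺ = X (suc (toℕ r))
    X⁻ = X (toℕ r)

  isSignMatrix : (∀ j → X 0 j ≡ 0) → (∀ t → t ≤ p → ∀ j → X t j ≤ 1) → (∀ t → t < p → X t ≼[ n ] X (suc t)) →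
    IsSignMatrix M
  isSignMatrix X₀≡0 X≤1 X-mono = entries , colSums , rowSums
    where
    entries : ∀ r j → IsSignEntry (M r j)
    entries r j = isSignEntry-diff (X≤1 _ (Finₚ.toℕ<n r) (toℕ j)) (X≤1 _ (ℕₚ.<⇒≤ (Finₚ.toℕ<n r)) (toℕ j))
    colSums : ∀ j t → (sumUpTo (λ r → M r j) t ≡ + 0) ⊎ (sumUpTo (λ r → M r j) t ≡ + 1)
    colSums j t = Sum.map (trans colSum-t) (trans colSum-t) (≤1⇒0∨1 (X≤1 (t ⊓ p) (ℕₚ.m⊓n≤n t p) (toℕ j)))
      where colSum-t = trans (sumUpTo-⊓ (λ r → M r j) t) (colSum X₀≡0 (t ⊓ p) (ℕₚ.m⊓n≤n t p) j)
    rowSums : ∀ r t → + 0 ℤ.≤ sumUpTo (M r) t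
    rowSums r t = subst (+ 0 ℤ.≤_) (sym (trans (sumUpTo-⊓ (M r) t) (rowSum X-mono r (t ⊓ n) (ℕₚ.m⊓n≤n t n)))) (+≤+ z≤n)

module _ {A : Set} {P : A → Set} (P? : Decidable P) where

  count≡0 : ∀ {k} (xs : Vec A k) → (∀ i → ¬ P (lookup xs i)) → count P? xs ≡ 0
  count≡0 []       _  = refl
  count≡0 (x ∷ xs) ¬P with P? x
  ... | yes Px = ⊥-elim (¬P zero Px)
  ... | no  _  = count≡0 xs (λ i → ¬P (suc i))

  count≡n : ∀ {k} (xs : Vec A k) → (∀ i → P (lookup xs i)) → count P? xs ≡ k
  count≡n []       _  = refl
  count≡n (x ∷ xs) P′ with P? x
  ... | yes _  = cong suc (count≡n xs (λ i → P′ (suc i)))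
  ... | no ¬Px = ⊥-elim (¬Px (P′ zero))

  0<count : ∀ {k} (xs : Vec A k) i → P (lookup xs i) → 1 ≤ count P? xs
  0<count (x ∷ xs) i       Pxᵢ with P? x
  ... | yes _ = s≤s z≤n
  0<count (x ∷ xs) zero    Px  | no ¬Px = ⊥-elim (¬Px Px)
  0<count (x ∷ xs) (suc i) Pxᵢ | no _   = 0<count xs i Pxᵢ

  count<n : ∀ {k} (xs : Vec A k) i → ¬ P (lookup xs i) → count P? xs < k
  count<n (x ∷ xs) i       ¬Pxᵢ with P? x
  ... | no _ = s≤s (count≤n P? xs)
  count<n (x ∷ xs) zero    ¬Px  | yes Px = ⊥-elim (¬Px Px)
  count<n (x ∷ xs) (suc i) ¬Pxᵢ | yes _  = s≤s (count<n xs i ¬Pxᵢ)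

  count-⊎ : ∀ {Q R : A → Set} (Q? : Decidable Q) (R? : Decidable R) →
    (∀ x → P x → Q x ⊎ R x) → (∀ x → Q x → P x) → (∀ x → R x → P x) → (∀ x → Q x → ¬ R x) →
    ∀ {k} (xs : Vec A k) → count P? xs ≡ count Q? xs ℕ.+ count R? xs
  count-⊎ Q? R? P⇒Q⊎R Q⇒P R⇒P Q⇒¬R []       = refl
  count-⊎ Q? R? P⇒Q⊎R Q⇒P R⇒P Q⇒¬R (x ∷ xs) with P? x | Q? x | R? x
  ... | _      | yes Qx  | yes Rx  = ⊥-elim (Q⇒¬R x Qx Rx)
  ... | yes _  | yes _   | no _    = cong suc (count-⊎ Q? R? P⇒Q⊎R Q⇒P R⇒P Q⇒¬R xs)
  ... | yes _  | no _    | yes _   = trans (cong suc (count-⊎ Q? R? P⇒Q⊎R Q⇒P R⇒P Q⇒¬R xs)) (sym (ℕₚ.+-suc _ _))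
  ... | yes Px | no ¬Qx  | no ¬Rx  = ⊥-elim ([ ¬Qx , ¬Rx ]′ (P⇒Q⊎R x Px))
  ... | no ¬Px | yes Qx  | no _    = ⊥-elim (¬Px (Q⇒P x Qx))
  ... | no ¬Px | no _    | yes Rx  = ⊥-elim (¬Px (R⇒P x Rx))
  ... | no _   | no _    | no _    = count-⊎ Q? R? P⇒Q⊎R Q⇒P R⇒P Q⇒¬R xs

partsAtLeast : ∀ {k} → Vec ℕ k → ℕ → ℕ
partsAtLeast xs m = count (m ≤?_) xs

partsAtLeast-suc : ∀ {k} (xs : Vec ℕ k) m → partsAtLeast xs m ≡ partsAtLeast xs (suc m) ℕ.+ mult xs m
partsAtLeast-suc xs m = count-⊎ (m ≤?_) (suc m ≤?_) (_≟ m) split (λ _ → ℕₚ.<⇒≤) (λ _ x≡m → ℕₚ.≤-reflexive (sym x≡m))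
  (λ _ m<x x≡m → ℕₚ.<-irrefl (sym x≡m) m<x) xs
  where
  split : ∀ x → m ≤ x → m < x ⊎ x ≡ m
  split x m≤x = Sum.map₂ sym (ℕₚ.m≤n⇒m<n∨m≡n m≤x)

part≤firstPart : ∀ {k} (xs : Vec ℕ k) → IsPartition xs → ∀ i → lookup xs i ≤ firstPart xs
part≤firstPart (x ∷ xs) (_ , decreasing) i = decreasing zero i z≤n

lastPart≡lookup-last : ∀ {k} (xs : Vec ℕ (suc k)) → lastPart xs ≡ lookup xs (Fin.fromℕ k)
lastPart≡lookup-last (x ∷ [])     = refl
lastPart≡lookup-last (x ∷ y ∷ ys) = lastPart≡lookup-last (y ∷ ys)

lastPart≤part : ∀ {k} (xs : Vec ℕ (suc k)) → IsPartition xs → ∀ i → lastPart xs ≤ lookup xs i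
lastPart≤part {k} xs (_ , decreasing) i =
  subst (_≤ lookup xs i) (sym (lastPart≡lookup-last xs)) (decreasing i (Fin.fromℕ k) (Finₚ.≤fromℕ i))

lastPart≤firstPart : ∀ {k} (xs : Vec ℕ (suc k)) → IsPartition xs → lastPart xs ≤ firstPart xs
lastPart≤firstPart (x ∷ xs) P = lastPart≤part (x ∷ xs) P zero

-- a_L + ⋯ + a_{L+1-t} with L = λ₁: the sum of the first t rows of every matrix in M(λ,n).
weight : ∀ {k} → Vec ℕ k → ℕ → ℕ
weight xs t = partsAtLeast xs (suc (firstPart xs) ∸ t)

weight-zero : ∀ {k} (xs : Vec ℕ k) → IsPartition xs → weight xs 0 ≡ 0
weight-zero xs P = count≡0 _ xs (λ i → ℕₚ.<⇒≱ (s≤s (part≤firstPart xs P i)))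

weight-suc : ∀ {k} (xs : Vec ℕ k) t → t ≤ firstPart xs → weight xs (suc t) ≡ weight xs t ℕ.+ mult xs (firstPart xs ∸ t)
weight-suc xs t t≤L = trans (partsAtLeast-suc xs (firstPart xs ∸ t))
  (cong (λ m → partsAtLeast xs m ℕ.+ mult xs (firstPart xs ∸ t)) (sym (ℕₚ.+-∸-assoc 1 t≤L)))

weight≤k : ∀ {k} (xs : Vec ℕ k) t → weight xs t ≤ k
weight≤k xs t = count≤n _ xs

weight-mono : ∀ {k} (xs : Vec ℕ k) t → t ≤ firstPart xs → weight xs t ≤ weight xs (suc t)
weight-mono xs t t≤L = subst (weight xs t ≤_) (sym (weight-suc xs t t≤L)) (ℕₚ.m≤m+n _ _)

weight-pos : ∀ {k} (xs : Vec ℕ k) t → 1 ≤ t → t ≤ firstPart xs → 1 ≤ weight xs t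
weight-pos []       t         1≤t t≤0 = ⊥-elim (ℕₚ.<⇒≱ 1≤t t≤0)
weight-pos (x ∷ xs) (suc t)   _   _   = 0<count (x ∸ t ≤?_) (x ∷ xs) zero (ℕₚ.m∸n≤m x t)

sumℕ-mult : ∀ {k} (xs : Vec ℕ k) → IsPartition xs → ∀ T → T ≤ firstPart xs →
  sumℕ T (λ t → mult xs (firstPart xs ∸ t)) ≡ weight xs T
sumℕ-mult xs P zero    _   = sym (weight-zero xs P)
sumℕ-mult xs P (suc T) T<L = begin
  sumℕ (suc T) (λ t → mult xs (L ∸ t))            ≡⟨ sumℕ-suc T _ ⟩
  sumℕ T (λ t → mult xs (L ∸ t)) ℕ.+ mult xs (L ∸ T) ≡⟨ cong (ℕ._+ mult xs (L ∸ T)) (sumℕ-mult xs P T (ℕₚ.<⇒≤ T<L)) ⟩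
  weight xs T ℕ.+ mult xs (L ∸ T)                 ≡⟨ weight-suc xs T (ℕₚ.<⇒≤ T<L) ⟨
  weight xs (suc T)                               ∎
  where
  open ≡-Reasoning
  L = firstPart xs

module _ {k} (xs : Vec ℕ (suc k)) (P : IsPartition xs) where

  private
    L = firstPart xs
    λₖ = lastPart xs

    λₖ≤L : λₖ ≤ L
    λₖ≤L = lastPart≤firstPart xs P

  weight<k : ∀ t → t ≤ L ∸ λₖ → weight xs t < suc k
  weight<k t t≤L-λₖ = count<n _ xs (Fin.fromℕ k) (ℕₚ.<⇒≱ (subst (_< suc L ∸ t) (lastPart≡lookup-last xs) λₖ<))
    where
    λₖ< : λₖ < suc L ∸ t
    λₖ< = begin-strict
      λₖ              ≡⟨ ℕₚ.m∸[m∸n]≡n λₖ≤L ⟨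
      L ∸ (L ∸ λₖ)    <⟨ s≤s ℕₚ.≤-refl ⟩
      suc (L ∸ (L ∸ λₖ)) ≡⟨ ℕₚ.+-∸-assoc 1 (ℕₚ.m∸n≤m L λₖ) ⟨
      suc L ∸ (L ∸ λₖ) ≤⟨ ℕₚ.∸-monoʳ-≤ (suc L) t≤L-λₖ ⟩
      suc L ∸ t       ∎
      where open ℕₚ.≤-Reasoning

  weight≡k : ∀ t → L ∸ λₖ < t → weight xs t ≡ suc k
  weight≡k t L-λₖ<t = count≡n _ xs (λ i → ℕₚ.≤-trans ≤λₖ (lastPart≤part xs P i))
    where
    ≤λₖ : suc L ∸ t ≤ λₖ
    ≤λₖ = ℕₚ.≤-trans (ℕₚ.∸-monoʳ-≤ (suc L) L-λₖ<t) (ℕₚ.≤-reflexive (ℕₚ.m∸[m∸n]≡n λₖ≤L))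

stateMatrix-InM : ∀ {k} (xs : Vec ℕ k) n (X : ℕ → ℕ → ℕ) → (∀ j → X 0 j ≡ 0) →
  (∀ t → t ≤ firstPart xs → IsState n (weight xs t) (X t)) → (∀ t → t < firstPart xs → X t ≼[ n ] X (suc t)) →
  InM xs n (stateMatrix (firstPart xs) n X)
stateMatrix-InM xs n X X₀≡0 X-state X-mono = isSignMatrix X₀≡0 (λ t t≤L → proj₁ (X-state t t≤L)) X-mono , rowTotals
  where
  L = firstPart xs
  open StateMatrix L n X
  rowTotals : ∀ r → sumAll (M r) ≡ + mult xs (L ∸ toℕ r)
  rowTotals r = trans (rowSum X-mono r n ℕₚ.≤-refl) (cong +_ (begin
    sumℕ n (X (suc (toℕ r))) ∸ sumℕ n (X (toℕ r))          ≡⟨ cong₂ _∸_ (proj₂ (X-state _ r<L)) (proj₂ (X-state _ (ℕₚ.<⇒≤ r<L))) ⟩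
    weight xs (suc (toℕ r)) ∸ weight xs (toℕ r)            ≡⟨ cong (_∸ weight xs (toℕ r)) (weight-suc xs (toℕ r) (ℕₚ.<⇒≤ r<L)) ⟩
    weight xs (toℕ r) ℕ.+ mult xs (L ∸ toℕ r) ∸ weight xs (toℕ r) ≡⟨ ℕₚ.m+n∸m≡n (weight xs (toℕ r)) _ ⟩
    mult xs (L ∸ toℕ r)                                    ∎))
    where
    open ≡-Reasoning
    r<L = Finₚ.toℕ<n r

colSums-total : ∀ {k} (xs : Vec ℕ k) → IsPartition xs → ∀ {n} (M : Mat (firstPart xs) n) → InM xs n M →
  ∀ T → T ≤ firstPart xs → sumAll (λ j → sumUpTo (λ r → M r j) T) ≡ + weight xs T
colSums-total xs P {n} M (_ , rowTotals) T T≤L = begin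
  sumAll (λ j → sumUpTo (λ r → M r j) T)           ≡⟨ sumUpTo-swap M T n ⟨
  sumUpTo (λ r → sumAll (M r)) T                   ≡⟨ sumUpTo-cong rowTotals T ⟩
  sumUpTo {L} (λ r → + mult xs (L ∸ toℕ r)) T      ≡⟨ sumUpTo-toℕ (λ t → + mult xs (L ∸ t)) T T≤L ⟩
  sumℤ T (λ t → + mult xs (L ∸ t))                 ≡⟨ sumℤ-ofℕ T (λ t → mult xs (L ∸ t)) ⟩
  + sumℕ T (λ t → mult xs (L ∸ t))                 ≡⟨ cong +_ (sumℕ-mult xs P T T≤L) ⟩
  + weight xs T                                    ∎
  where
  open ≡-Reasoning
  L = firstPart xs

-- Packed states and probes

module States (n : ℕ) where

  leftState : ℕ → ℕ → ℕ
  leftState w = interval 0 w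

  rightState : ℕ → ℕ → ℕ
  rightState w = interval (n ∸ w) n

  leftState-isState : ∀ w → w ≤ n → IsState n w (leftState w)
  leftState-isState w w≤n = interval≤1 0 w , trans (sumℕ-interval n 0 w) (ℕₚ.m≥n⇒m⊓n≡n w≤n)

  rightState-isState : ∀ w → w ≤ n → IsState n w (rightState w)
  rightState-isState w w≤n = interval≤1 (n ∸ w) n ,
    trans (sumℕ-interval n (n ∸ w) n) (trans (cong (_∸ (n ∸ w)) (ℕₚ.⊓-idem n)) (ℕₚ.m∸[m∸n]≡n w≤n))

  ≼-leftState : ∀ {g w w′} → IsState n w g → w ≤ w′ → g ≼[ n ] leftState w′
  ≼-leftState {g} {w} {w′} (g≤1 , Σg≡w) w≤w′ J J≤n rewrite sumℕ-interval J 0 w′ =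
    ℕₚ.⊓-glb (sumℕ-≤-length J g g≤1) (ℕₚ.≤-trans (sumℕ-mono g J≤n) (subst (_≤ _) (sym Σg≡w) w≤w′))

  rightState-≼ : ∀ {g w w′} → IsState n w′ g → w ≤ w′ → w ≤ n → rightState w ≼[ n ] g
  rightState-≼ {g} {w} {w′} (g≤1 , Σg≡w′) w≤w′ w≤n J J≤n
    rewrite sumℕ-interval J (n ∸ w) n | ℕₚ.m≤n⇒m⊓n≡m J≤n =
    ℕₚ.m≤n+o⇒m∸n≤o J (n ∸ w) (ℕₚ.+-cancelʳ-≤ (n ∸ J) J _ J+[n∸J]≤)
    where
    open ℕₚ.≤-Reasoning
    J+[n∸J]≤ : J ℕ.+ (n ∸ J) ≤ (n ∸ w) ℕ.+ sumℕ J g ℕ.+ (n ∸ J)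
    J+[n∸J]≤ = begin
      J ℕ.+ (n ∸ J)                           ≡⟨ ℕₚ.m+[n∸m]≡n J≤n ⟩
      n                                       ≡⟨ ℕₚ.m∸n+n≡m w≤n ⟨
      (n ∸ w) ℕ.+ w                           ≤⟨ ℕₚ.+-monoʳ-≤ (n ∸ w) w≤w′ ⟩
      (n ∸ w) ℕ.+ w′                          ≡⟨ cong ((n ∸ w) ℕ.+_) Σg≡w′ ⟨
      (n ∸ w) ℕ.+ sumℕ n g                    ≤⟨ ℕₚ.+-monoʳ-≤ (n ∸ w) (sumℕ-≤-prefix g g≤1 J≤n) ⟩
      (n ∸ w) ℕ.+ (sumℕ J g ℕ.+ (n ∸ J))      ≡⟨ ℕₚ.+-assoc (n ∸ w) _ _ ⟨
      (n ∸ w) ℕ.+ sumℕ J g ℕ.+ (n ∸ J)        ∎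

  -- leftState S with one entry moved: the last one to position S + i while such
  -- positions remain, and afterwards the one at position q = i - (n - S) to position S.
  probe : ℕ → ℕ → ℕ → ℕ
  probe S i with i <? n ∸ S
  ... | yes _ = blocks (S ∸ 1) (S ℕ.+ i) (suc (S ℕ.+ i))
  ... | no  _ = blocks (i ∸ (n ∸ S)) (suc (i ∸ (n ∸ S))) (suc S)

  probePos : ℕ → ℕ → ℕ
  probePos S i with i <? n ∸ S
  ... | yes _ = S ℕ.+ i
  ... | no  _ = i ∸ (n ∸ S)

  module Probe {S i : ℕ} (1≤S : 1 ≤ S) (S<n : S < n) (i<n-1 : i < n ∸ 1) where

    S+i<n : i < n ∸ S → S ℕ.+ i < n
    S+i<n i<n-S = begin-strict
      S ℕ.+ i         <⟨ ℕₚ.+-monoʳ-< S i<n-S ⟩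
      S ℕ.+ (n ∸ S)   ≡⟨ ℕₚ.m+[n∸m]≡n (ℕₚ.<⇒≤ S<n) ⟩
      n               ∎
      where open ℕₚ.≤-Reasoning

    q<S-1 : n ∸ S ≤ i → i ∸ (n ∸ S) < S ∸ 1
    q<S-1 n-S≤i = begin-strict
      i ∸ (n ∸ S)         <⟨ ℕₚ.∸-monoˡ-< i<n-1 n-S≤i ⟩
      n ∸ 1 ∸ (n ∸ S)     ≡⟨ ℕₚ.∸-+-assoc n 1 (n ∸ S) ⟩
      n ∸ (1 ℕ.+ (n ∸ S)) ≡⟨ cong (n ∸_) (ℕₚ.+-comm 1 (n ∸ S)) ⟩
      n ∸ ((n ∸ S) ℕ.+ 1) ≡⟨ ℕₚ.∸-+-assoc n (n ∸ S) 1 ⟨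
      n ∸ (n ∸ S) ∸ 1     ≡⟨ cong (_∸ 1) (ℕₚ.m∸[m∸n]≡n (ℕₚ.<⇒≤ S<n)) ⟩
      S ∸ 1               ∎
      where open ℕₚ.≤-Reasoning

    q<S : n ∸ S ≤ i → i ∸ (n ∸ S) < S
    q<S n-S≤i = ℕₚ.<-≤-trans (q<S-1 n-S≤i) (ℕₚ.m∸n≤m S 1)

    probePos<n : probePos S i < n
    probePos<n with i <? n ∸ S
    ... | yes i<n-S = S+i<n i<n-S
    ... | no  i≮n-S = ℕₚ.<-trans (q<S (ℕₚ.≮⇒≥ i≮n-S)) S<n

    probe-isState : IsState n S (probe S i)
    probe-isState with i <? n ∸ S
    ... | yes i<n-S = (λ j → blocks≤1 (suc (S ℕ.+ i)) j (ℕₚ.≤-trans (ℕₚ.m∸n≤m S 1) (ℕₚ.m≤m+n S i))) , (begin-equality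
      sumℕ n (blocks (S ∸ 1) (S ℕ.+ i) (suc (S ℕ.+ i)))        ≡⟨ sumℕ-blocks n (S ∸ 1) (S ℕ.+ i) (suc (S ℕ.+ i)) ⟩
      n ⊓ (S ∸ 1) ℕ.+ (n ⊓ suc (S ℕ.+ i) ∸ (S ℕ.+ i))         ≡⟨ cong₂ (λ a b → a ℕ.+ (b ∸ (S ℕ.+ i)))
                                                                   (ℕₚ.m≥n⇒m⊓n≡n (ℕₚ.≤-trans (ℕₚ.m∸n≤m S 1) (ℕₚ.<⇒≤ S<n)))
                                                                   (ℕₚ.m≥n⇒m⊓n≡n (S+i<n i<n-S)) ⟩
      (S ∸ 1) ℕ.+ (suc (S ℕ.+ i) ∸ (S ℕ.+ i))                 ≡⟨ cong ((S ∸ 1) ℕ.+_) (ℕₚ.m+n∸n≡m 1 (S ℕ.+ i)) ⟩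
      (S ∸ 1) ℕ.+ 1                                           ≡⟨ ℕₚ.m∸n+n≡m 1≤S ⟩
      S                                                       ∎)
      where open ℕₚ.≤-Reasoning
    ... | no  i≮n-S = (λ j → blocks≤1 (suc S) j (ℕₚ.n≤1+n q)) , (begin-equality
      sumℕ n (blocks q (suc q) (suc S))                       ≡⟨ sumℕ-blocks n q (suc q) (suc S) ⟩
      n ⊓ q ℕ.+ (n ⊓ suc S ∸ suc q)                           ≡⟨ cong₂ (λ a b → a ℕ.+ (b ∸ suc q))
                                                                   (ℕₚ.m≥n⇒m⊓n≡n (ℕₚ.<⇒≤ (ℕₚ.<-trans q<S′ S<n)))
                                                                   (ℕₚ.m≥n⇒m⊓n≡n S<n) ⟩
      q ℕ.+ (S ∸ q)                                           ≡⟨ ℕₚ.m+[n∸m]≡n (ℕₚ.<⇒≤ q<S′) ⟩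
      S                                                       ∎)
      where
      open ℕₚ.≤-Reasoning
      q = i ∸ (n ∸ S)
      q<S′ = q<S (ℕₚ.≮⇒≥ i≮n-S)

    probe-diagonal : probe S i (probePos S i) ≢ leftState S (probePos S i)
    probe-diagonal with i <? n ∸ S
    ... | yes i<n-S = λ 1≡0 → ℕₚ.1+n≢0 (trans (sym probe≡1) (trans 1≡0 left≡0))
      where
      probe≡1 : blocks (S ∸ 1) (S ℕ.+ i) (suc (S ℕ.+ i)) (S ℕ.+ i) ≡ 1
      probe≡1 = cong₂ ℕ._+_ (interval-above {0} (ℕₚ.≤-trans (ℕₚ.m∸n≤m S 1) (ℕₚ.m≤m+n S i)))
                            (interval-inside {S ℕ.+ i} ℕₚ.≤-refl ℕₚ.≤-refl)
      left≡0 : leftState S (S ℕ.+ i) ≡ 0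
      left≡0 = interval-above {0} (ℕₚ.m≤m+n S i)
    ... | no  i≮n-S = λ 0≡1 → ℕₚ.1+n≢0 (trans (sym left≡1) (trans (sym 0≡1) probe≡0))
      where
      q = i ∸ (n ∸ S)
      probe≡0 : blocks q (suc q) (suc S) q ≡ 0
      probe≡0 = cong₂ ℕ._+_ (interval-above {0} {q} ℕₚ.≤-refl) (interval-below {suc q} {suc S} ℕₚ.≤-refl)
      left≡1 : leftState S q ≡ 1
      left≡1 = interval-inside z≤n (q<S (ℕₚ.≮⇒≥ i≮n-S))

    probe-earlier : ∀ {i′} → i′ < i → probe S i′ (probePos S i) ≡ leftState S (probePos S i)
    probe-earlier {i′} i′<i with i <? n ∸ S | i′ <? n ∸ S
    ... | yes i<n-S | no i′≮n-S = ⊥-elim (i′≮n-S (ℕₚ.<-trans i′<i i<n-S))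
    ... | yes _     | yes _     = begin
      blocks (S ∸ 1) (S ℕ.+ i′) (suc (S ℕ.+ i′)) (S ℕ.+ i)  ≡⟨ cong₂ ℕ._+_
                                                                (interval-above {0} (ℕₚ.≤-trans (ℕₚ.m∸n≤m S 1) (ℕₚ.m≤m+n S i)))
                                                                (interval-above {S ℕ.+ i′} (ℕₚ.≤-trans (ℕₚ.≤-reflexive (sym (ℕₚ.+-suc S i′)))
                                                                                            (ℕₚ.+-monoʳ-≤ S i′<i))) ⟩
      0                                                    ≡⟨ interval-above {0} (ℕₚ.m≤m+n S i) ⟨
      leftState S (S ℕ.+ i)                                ∎
      where open ≡-Reasoning
    ... | no i≮n-S  | yes _     = begin
      blocks (S ∸ 1) (S ℕ.+ i′) (suc (S ℕ.+ i′)) q          ≡⟨ cong₂ ℕ._+_ (interval-inside z≤n (q<S-1 (ℕₚ.≮⇒≥ i≮n-S)))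
                                                                          (interval-below (ℕₚ.<-≤-trans (q<S (ℕₚ.≮⇒≥ i≮n-S)) (ℕₚ.m≤m+n S i′))) ⟩
      1                                                    ≡⟨ interval-inside z≤n (q<S (ℕₚ.≮⇒≥ i≮n-S)) ⟨
      leftState S q                                        ∎
      where
      open ≡-Reasoning
      q = i ∸ (n ∸ S)
    ... | no i≮n-S  | no i′≮n-S = begin
      blocks q′ (suc q′) (suc S) q                         ≡⟨ cong₂ ℕ._+_ (interval-above {0} (ℕₚ.<⇒≤ q′<q))
                                                                          (interval-inside q′<q (ℕₚ.m≤n⇒m≤1+n (q<S (ℕₚ.≮⇒≥ i≮n-S)))) ⟩
      1                                                    ≡⟨ interval-inside z≤n (q<S (ℕₚ.≮⇒≥ i≮n-S)) ⟨
      leftState S q                                        ∎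
      where
      open ≡-Reasoning
      q = i ∸ (n ∸ S)
      q′ = i′ ∸ (n ∸ S)
      q′<q : q′ < q
      q′<q = ℕₚ.∸-monoˡ-< i′<i (ℕₚ.≮⇒≥ i′≮n-S)

-- The two bounds

≢last⇒< : ∀ {n} (i j : Fin n) → i ≢ j → n ∸ 1 ≤ toℕ j → toℕ i < n ∸ 1
≢last⇒< {suc n} i j i≢j n≤j = ℕₚ.≤∧≢⇒< (ℕ.s≤s⁻¹ (Finₚ.toℕ<n i))
  (λ i≡n → i≢j (Finₚ.toℕ-injective (trans i≡n (ℕₚ.≤-antisym n≤j (ℕ.s≤s⁻¹ (Finₚ.toℕ<n j))))))

module UpperBound {k} (xs : Vec ℕ k) (n R : ℕ) (R≤L : R ≤ firstPart xs)
  (full : ∀ M → InM xs n M → ∀ T → R < T → T ≤ firstPart xs → ∀ j → sumUpTo (λ r → M r j) T ≡ + 1) where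

  private
    L = firstPart xs
    d = R ℕ.* (n ∸ 1)

  blockRow : Fin d → Fin L
  blockRow x = Fin.inject≤ (proj₁ (Fin.remQuot (n ∸ 1) x)) R≤L

  blockCol : Fin d → Fin n
  blockCol x = Fin.inject≤ (proj₂ (Fin.remQuot {R} (n ∸ 1) x)) (ℕₚ.m∸n≤m n 1)

  block-surjective : ∀ r j → toℕ r < R → toℕ j < n ∸ 1 → ∃ λ x → blockRow x ≡ r × blockCol x ≡ j
  block-surjective r j r<R j<n-1 = x , Finₚ.toℕ-injective row≡ , Finₚ.toℕ-injective col≡
    where
    x = Fin.combine (Fin.fromℕ< r<R) (Fin.fromℕ< j<n-1)
    remQuot≡ = Finₚ.remQuot-combine (Fin.fromℕ< r<R) (Fin.fromℕ< j<n-1)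
    row≡ : toℕ (blockRow x) ≡ toℕ r
    row≡ = trans (Finₚ.toℕ-inject≤ _ R≤L) (trans (cong (toℕ ∘ proj₁) remQuot≡) (Finₚ.toℕ-fromℕ< r<R))
    col≡ : toℕ (blockCol x) ≡ toℕ j
    col≡ = trans (Finₚ.toℕ-inject≤ _ (ℕₚ.m∸n≤m n 1)) (trans (cong (toℕ ∘ proj₂) remQuot≡) (Finₚ.toℕ-fromℕ< j<n-1))

  determined : AffinelyDeterminedAt (InM xs n) blockRow blockCol
  determined c v v∈M Σc≡0 E≡0-at = E≡0
    where
    E = lincomb c v
    block≡0 : ∀ r j → toℕ r < R → toℕ j < n ∸ 1 → E r j ≡ + 0
    block≡0 r j r<R j<n-1 with x , refl , refl ← block-surjective r j r<R j<n-1 = E≡0-at x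
    rowTotal≡0 : ∀ r → sumAll (E r) ≡ + 0
    rowTotal≡0 r = trans (lincomb-rowSum c v r n) (sumAll-*-constant c _ _ Σc≡0 (λ i → proj₂ (v∈M i) r))
    colSum≡0 : ∀ T → R < T → T ≤ L → ∀ j → sumUpTo (λ r → E r j) T ≡ + 0
    colSum≡0 T R<T T≤L j = trans (lincomb-colSum c v j T) (sumAll-*-constant c _ (+ 1) Σc≡0 (λ i → full (v i) (v∈M i) T R<T T≤L j))
    upperRow≡0 : ∀ r j → toℕ r < R → E r j ≡ + 0
    upperRow≡0 r j r<R with toℕ j <? n ∸ 1
    ... | yes j<n-1 = block≡0 r j r<R j<n-1
    ... | no  j≮n-1 = trans (sym (sumAll-single (E r) j (λ i i≢j → block≡0 r i r<R (≢last⇒< i j i≢j (ℕₚ.≮⇒≥ j≮n-1)))))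
                            (rowTotal≡0 r)
    lowerRow≡0 : ∀ r j → R ≤ toℕ r → E r j ≡ + 0
    lowerRow≡0 r j R≤r = begin
      E r j                                             ≡⟨ ℤₚ.+-identityˡ (E r j) ⟨
      + 0 + E r j                                       ≡⟨ cong (_+ E r j) above≡0 ⟨
      sumUpTo (λ r′ → E r′ j) (toℕ r) + E r j           ≡⟨ sumUpTo-suc (λ r′ → E r′ j) r ⟨
      sumUpTo (λ r′ → E r′ j) (suc (toℕ r))             ≡⟨ colSum≡0 (suc (toℕ r)) (s≤s R≤r) (Finₚ.toℕ<n r) j ⟩
      + 0                                               ∎
      where
      open ≡-Reasoning
      above≡0 : sumUpTo (λ r′ → E r′ j) (toℕ r) ≡ + 0
      above≡0 with ℕₚ.m≤n⇒m<n∨m≡n R≤r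
      ... | inj₁ R<r = colSum≡0 (toℕ r) R<r (ℕₚ.<⇒≤ (Finₚ.toℕ<n r)) j
      ... | inj₂ R≡r = sumUpTo-zero< (λ r′ → E r′ j) (toℕ r) (λ r′ r′<r → upperRow≡0 r′ j (subst (toℕ r′ <_) (sym R≡r) r′<r))
    E≡0 : ∀ r j → E r j ≡ + 0
    E≡0 r j with toℕ r <? R
    ... | yes r<R = upperRow≡0 r j r<R
    ... | no  r≮R = lowerRow≡0 r j (ℕₚ.≮⇒≥ r≮R)

  noAffIndep : ∀ (v : Fin (suc (suc d)) → Mat L n) → (∀ i → InM xs n (v i)) → ¬ AffIndep v
  noAffIndep = ¬AffIndep-determinedAt {S = InM xs n} blockRow blockCol determined

lex-< : ∀ {k a a′ b b′} → b < k → k ℕ.* a′ ℕ.+ b′ < k ℕ.* a ℕ.+ b → a′ < a ⊎ (a′ ≡ a × b′ < b)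
lex-< {k} {a} {a′} {b} {b′} b<k lt with ℕₚ.<-cmp a′ a
... | tri< a′<a _ _ = inj₁ a′<a
... | tri≈ _ refl _ = inj₂ (refl , ℕₚ.+-cancelˡ-< (k ℕ.* a) b′ b lt)
... | tri> _ _ a<a′ = ⊥-elim (ℕₚ.<-asym lt (begin-strict
  k ℕ.* a ℕ.+ b       <⟨ ℕₚ.+-monoʳ-< (k ℕ.* a) b<k ⟩
  k ℕ.* a ℕ.+ k       ≡⟨ trans (ℕₚ.+-comm (k ℕ.* a) k) (sym (ℕₚ.*-suc k a)) ⟩
  k ℕ.* suc a         ≤⟨ ℕₚ.*-monoʳ-≤ k a<a′ ⟩
  k ℕ.* a′            ≤⟨ ℕₚ.m≤m+n (k ℕ.* a′) b′ ⟩
  k ℕ.* a′ ℕ.+ b′     ∎))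
  where open ℕₚ.≤-Reasoning

module LowerBound {k} (xs : Vec ℕ k) (P : IsPartition xs) (n R : ℕ) (k≤n : k ≤ n) (R≤L : R ≤ firstPart xs)
  (weight<n : ∀ t → 1 ≤ t → t ≤ R → weight xs t < n) where

  open States n

  private
    L = firstPart xs
    W = weight xs
    d = R ℕ.* (n ∸ 1)

  W≤n : ∀ t → W t ≤ n
  W≤n t = ℕₚ.≤-trans (weight≤k xs t) k≤n

  baseStates : ℕ → ℕ → ℕ
  baseStates t = leftState (W t)

  baseStates-isState : ∀ t → IsState n (W t) (baseStates t)
  baseStates-isState t = leftState-isState (W t) (W≤n t)

  baseStates-zero : ∀ j → baseStates 0 j ≡ 0
  baseStates-zero j rewrite weight-zero xs P = refl

  base-InM : InM xs n (stateMatrix L n baseStates)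
  base-InM = stateMatrix-InM xs n baseStates baseStates-zero (λ t _ → baseStates-isState t)
    (λ t t<L → ≼-leftState (baseStates-isState t) (weight-mono xs t (ℕₚ.<⇒≤ t<L)))

  pointStates : ℕ → ℕ → ℕ → ℕ → ℕ
  pointStates ρ i t with ℕₚ.<-cmp t ρ
  ... | tri< _ _ _ = rightState (W t)
  ... | tri≈ _ _ _ = probe (W ρ) i
  ... | tri> _ _ _ = leftState (W t)

  pointStates-< : ∀ {ρ i t} → t < ρ → pointStates ρ i t ≡ rightState (W t)
  pointStates-< {ρ} {i} {t} t<ρ with ℕₚ.<-cmp t ρ
  ... | tri< _ _ _    = refl
  ... | tri≈ t≮ρ _ _  = ⊥-elim (t≮ρ t<ρ)
  ... | tri> t≮ρ _ _  = ⊥-elim (t≮ρ t<ρ)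

  pointStates-≡ : ∀ ρ i → pointStates ρ i ρ ≡ probe (W ρ) i
  pointStates-≡ ρ i with ℕₚ.<-cmp ρ ρ
  ... | tri< _ ρ≢ρ _ = ⊥-elim (ρ≢ρ refl)
  ... | tri≈ _ _ _   = refl
  ... | tri> _ ρ≢ρ _ = ⊥-elim (ρ≢ρ refl)

  pointStates-> : ∀ {ρ i t} → ρ < t → pointStates ρ i t ≡ leftState (W t)
  pointStates-> {ρ} {i} {t} ρ<t with ℕₚ.<-cmp t ρ
  ... | tri< _ _ ρ≮t = ⊥-elim (ρ≮t ρ<t)
  ... | tri≈ _ _ ρ≮t = ⊥-elim (ρ≮t ρ<t)
  ... | tri> _ _ _   = refl

  module Point {ρ i : ℕ} (1≤ρ : 1 ≤ ρ) (ρ≤R : ρ ≤ R) (i<n-1 : i < n ∸ 1) where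

    open Probe (weight-pos xs ρ 1≤ρ (ℕₚ.≤-trans ρ≤R R≤L)) (weight<n ρ 1≤ρ ρ≤R) i<n-1 public

    point-isState : ∀ t → IsState n (W t) (pointStates ρ i t)
    point-isState t with ℕₚ.<-cmp t ρ
    ... | tri< _ _ _    = rightState-isState (W t) (W≤n t)
    ... | tri≈ _ refl _ = probe-isState
    ... | tri> _ _ _    = baseStates-isState t

    point-zero : ∀ j → pointStates ρ i 0 j ≡ 0
    point-zero j rewrite pointStates-< {ρ} {i} 1≤ρ | weight-zero xs P = interval-empty n j

    point-mono : ∀ t → t < L → pointStates ρ i t ≼[ n ] pointStates ρ i (suc t)
    point-mono t t<L with t <? ρ
    ... | yes t<ρ rewrite pointStates-< {ρ} {i} t<ρ =
      rightState-≼ (point-isState (suc t)) (weight-mono xs t (ℕₚ.<⇒≤ t<L)) (W≤n t)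
    ... | no  t≮ρ rewrite pointStates-> {ρ} {i} (s≤s (ℕₚ.≮⇒≥ t≮ρ)) =
      ≼-leftState (point-isState t) (weight-mono xs t (ℕₚ.<⇒≤ t<L))

    point-InM : InM xs n (stateMatrix L n (pointStates ρ i))
    point-InM = stateMatrix-InM xs n (pointStates ρ i) point-zero (λ t _ → point-isState t) point-mono

  quot : Fin d → Fin R
  quot x = proj₁ (Fin.remQuot (n ∸ 1) x)

  idx : Fin d → Fin (n ∸ 1)
  idx x = proj₂ (Fin.remQuot {R} (n ∸ 1) x)

  ρ : Fin d → ℕ
  ρ x = suc (toℕ (quot x))

  toℕ-remQuot : ∀ x → toℕ x ≡ (n ∸ 1) ℕ.* toℕ (quot x) ℕ.+ toℕ (idx x)
  toℕ-remQuot x = trans (cong toℕ (sym (Finₚ.combine-remQuot {R} (n ∸ 1) x))) (Finₚ.toℕ-combine (quot x) (idx x))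

  module PointAt (x : Fin d) = Point {ρ x} {toℕ (idx x)} (s≤s z≤n) (Finₚ.toℕ<n (quot x)) (Finₚ.toℕ<n (idx x))

  col : Fin d → Fin n
  col x = Fin.fromℕ< (PointAt.probePos<n x)

  pos : Fin d → ℕ
  pos x = probePos (W (ρ x)) (toℕ (idx x))

  u : Fin (suc d) → Mat L n
  u zero    = stateMatrix L n baseStates
  u (suc y) = stateMatrix L n (pointStates (ρ y) (toℕ (idx y)))

  u-InM : ∀ i → InM xs n (u i)
  u-InM zero    = base-InM
  u-InM (suc y) = PointAt.point-InM y

  f : Fin d → Mat L n → ℤ
  f x M = sumUpTo (λ r → M r (col x)) (ρ x)

  f-stateMatrix : ∀ x X → (∀ j → X 0 j ≡ 0) → f x (stateMatrix L n X) ≡ + X (ρ x) (pos x)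
  f-stateMatrix x X X₀≡0 = trans (StateMatrix.colSum L n X X₀≡0 (ρ x) (ℕₚ.≤-trans (Finₚ.toℕ<n (quot x)) R≤L) (col x))
    (cong (+_ ∘ X (ρ x)) (Finₚ.toℕ-fromℕ< _))

  f-base : ∀ x → f x (u zero) ≡ + leftState (W (ρ x)) (pos x)
  f-base x = f-stateMatrix x baseStates baseStates-zero

  f-point : ∀ x y → f x (u (suc y)) ≡ + pointStates (ρ y) (toℕ (idx y)) (ρ x) (pos x)
  f-point x y = f-stateMatrix x (pointStates (ρ y) (toℕ (idx y))) (PointAt.point-zero y)

  f-below : ∀ x y → y Fin.< x → f x (u (suc y)) ≡ f x (u zero)
  f-below x y y<x with lex-< (Finₚ.toℕ<n (idx x)) (subst₂ _<_ (toℕ-remQuot y) (toℕ-remQuot x) y<x)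
  ... | inj₁ qy<qx = trans (f-point x y) (trans (cong (λ g → + g (pos x)) (pointStates-> (s≤s qy<qx))) (sym (f-base x)))
  ... | inj₂ (qy≡qx , iy<ix) = begin
    f x (u (suc y))                                                  ≡⟨ f-point x y ⟩
    + pointStates (ρ y) (toℕ (idx y)) (ρ x) (pos x)                 ≡⟨ cong (λ q → + pointStates (suc q) (toℕ (idx y)) (ρ x) (pos x)) qy≡qx ⟩
    + pointStates (ρ x) (toℕ (idx y)) (ρ x) (pos x)                 ≡⟨ cong (λ g → + g (pos x)) (pointStates-≡ (ρ x) (toℕ (idx y))) ⟩
    + probe (W (ρ x)) (toℕ (idx y)) (pos x)                          ≡⟨ cong +_ (PointAt.probe-earlier x iy<ix) ⟩
    + leftState (W (ρ x)) (pos x)                                    ≡⟨ f-base x ⟨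
    f x (u zero)                                                     ∎
    where open ≡-Reasoning

  f-diagonal : ∀ x → f x (u (suc x)) ≢ f x (u zero)
  f-diagonal x fx≡ = PointAt.probe-diagonal x (ℤₚ.+-injective (begin
    + probe (W (ρ x)) (toℕ (idx x)) (pos x)                          ≡⟨ cong (λ g → + g (pos x)) (pointStates-≡ (ρ x) (toℕ (idx x))) ⟨
    + pointStates (ρ x) (toℕ (idx x)) (ρ x) (pos x)                 ≡⟨ f-point x x ⟨
    f x (u (suc x))                                                  ≡⟨ fx≡ ⟩
    f x (u zero)                                                     ≡⟨ f-base x ⟩
    + leftState (W (ρ x)) (pos x)                                    ∎))
    where open ≡-Reasoning

  affIndepPoints : Σ (Fin (suc d) → Mat L n) (λ v → (∀ i → InM xs n (v i)) × AffIndep v)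
  affIndepPoints = u , u-InM , triangular⇒AffIndep u f (λ x c → lincomb-colSum c u (col x) (ρ x))
    (λ x M M≡0 → sumUpTo-zero (λ r → M≡0 r (col x)) (ρ x)) f-below f-diagonal

proposition3p2 : ∀ (k n : ℕ) (λs : Vec ℕ k) → IsPartition λs → 1 ≤ n →
    ((1 ≤ k → k < n → HullDim (InM λs n) (firstPart λs ℕ.* (n ∸ 1))) ×
     (k ≡ n → HullDim (InM λs n) ((firstPart λs ∸ lastPart λs) ℕ.* (n ∸ 1))))
proposition3p2 k n λs P 1≤n = shortCase , squareCase 1≤n
  where
  L = firstPart λs

  shortCase : 1 ≤ k → k < n → HullDim (InM λs n) (L ℕ.* (n ∸ 1))
  shortCase _ k<n =
      LowerBound.affIndepPoints λs P n L (ℕₚ.<⇒≤ k<n) ℕₚ.≤-refl (λ t _ _ → ℕₚ.≤-<-trans (weight≤k λs t) k<n)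
    , UpperBound.noAffIndep λs n L ℕₚ.≤-refl (λ _ _ _ L<T T≤L → ⊥-elim (ℕₚ.<⇒≱ L<T T≤L))

  squareCase : 1 ≤ n → k ≡ n → HullDim (InM λs n) ((L ∸ lastPart λs) ℕ.* (n ∸ 1))
  squareCase (s≤s z≤n) refl =
      LowerBound.affIndepPoints λs P n R ℕₚ.≤-refl R≤L (λ t _ t≤R → weight<k λs P t t≤R)
    , UpperBound.noAffIndep λs n R R≤L columnsFull
    where
    R = L ∸ lastPart λs
    R≤L = ℕₚ.m∸n≤m L (lastPart λs)
    columnsFull : ∀ M → InM λs n M → ∀ T → R < T → T ≤ L → ∀ j → sumUpTo (λ r → M r j) T ≡ + 1
    columnsFull M M∈M@((_ , colSums01 , _) , _) T R<T T≤L =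
      sumAll≡m⇒≡1 (λ j → sumUpTo (λ r → M r j) T) (λ j → colSums01 j T)
        (trans (colSums-total λs P M M∈M T T≤L) (cong +_ (weight≡k λs P T R<T)))
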